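{- Let $H$ be a graph on vertex set $[k]$, let $F$ be a core of $H$, let $i\in\mathbb{N}$ and let $e\in\binom{[k]}{2}$. Then $F$ is in the $(i,e)$-boundary if and only if $H$ is in the $(i,e)$-boundary.
   Context: All graphs have vertex set $[k]$; for $S\subseteq[k]$, the vertex induced subgraph $H[S]$ is the graph on $[k]$ whose edges are the edges of $H$ with both endpoints in $S$. $\mathrm{vc}(H)$ denotes the minimum size of a vertex cover of $H$. A graph $H$ is in the $(i,e)$-boundary if $\mathrm{vc}(H)=i$ and $\mathrm{vc}(H\cup\{e\})=i+1$. A vertex induced subgraph $F$ of $H$ is a core of $H$ if every minimum vertex cover of $F$ is also a vertex cover of $H$. -}

module Defs where

open import Data.Nat using (ℕ; _≤_; suc)
open import Data.Fin using (Fin)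
open import Data.Bool using (Bool; true; false; _∧_; _∨_)
open import Data.Fin.Subset using (Subset; _∈_; ∣_∣)
open import Data.Vec using (lookup)
open import Data.Sum using (_⊎_)
open import Data.Product using (_×_; Σ; ∃)
open import Relation.Binary.PropositionalEquality using (_≡_; _≢_)
open import Relation.Nullary.Decidable using (⌊_⌋)
open import Data.Fin using (_≟_)

record Graph (k : ℕ) : Set where
  field
    adj    : Fin k → Fin k → Bool
    sym    : ∀ u v → adj u v ≡ adj v u
    irrefl : ∀ u → adj u u ≡ false
open Graph public

IsVertexCover : ∀ {k} → Graph k → Subset k → Set
IsVertexCover H C = ∀ u v → adj H u v ≡ true → (u ∈ C) ⊎ (v ∈ C)

IsMinVertexCover : ∀ {k} → Graph k → Subset k → Set
IsMinVertexCover H C =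
  IsVertexCover H C × (∀ D → IsVertexCover H D → ∣ C ∣ ≤ ∣ D ∣)

VC≡ : ∀ {k} → Graph k → ℕ → Set
VC≡ H i = Σ _ λ C → IsMinVertexCover H C × ∣ C ∣ ≡ i

-- Vertex induced subgraph H[S] (still on vertex set [k]).
induced : ∀ {k} → Graph k → Subset k → Graph k
induced H S = record
  { adj    = λ u v → adj H u v ∧ lookup S u ∧ lookup S v
  ; sym    = λ u v → symProof u v
  ; irrefl = λ u → irr u
  }
  where
  open import Data.Bool.Properties using (∧-comm; ∧-assoc)
  open import Relation.Binary.PropositionalEquality using (cong₂; trans; cong)
  symProof : ∀ u v → (adj H u v ∧ lookup S u ∧ lookup S v) ≡ (adj H v u ∧ lookup S v ∧ lookup S u)
  symProof u v = cong₂ _∧_ (Graph.sym H u v) (∧-comm (lookup S u) (lookup S v))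
  irr : ∀ u → (adj H u u ∧ lookup S u ∧ lookup S u) ≡ false
  irr u rewrite Graph.irrefl H u = _≡_.refl

samePair : ∀ {k} → Fin k → Fin k → Fin k → Fin k → Bool
samePair u v x y = (⌊ x ≟ u ⌋ ∧ ⌊ y ≟ v ⌋) ∨ (⌊ x ≟ v ⌋ ∧ ⌊ y ≟ u ⌋)

addEdge : ∀ {k} → Graph k → (u v : Fin k) → u ≢ v → Graph k
addEdge H u v u≢v = record
  { adj    = λ x y → adj H x y ∨ samePair u v x y
  ; sym    = symP
  ; irrefl = irrP
  }
  where
  open import Data.Bool.Properties using (∨-comm)
  open import Relation.Binary.PropositionalEquality using (cong₂; refl)
  open import Relation.Nullary using (yes; no)
  open import Data.Empty using (⊥-elim)
  symP : ∀ x y → (adj H x y ∨ samePair u v x y) ≡ (adj H y x ∨ samePair u v y x)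
  symP x y = cong₂ _∨_ (Graph.sym H x y)
    (trans₁ (∨-comm (⌊ x ≟ u ⌋ ∧ ⌊ y ≟ v ⌋) (⌊ x ≟ v ⌋ ∧ ⌊ y ≟ u ⌋))
      (cong₂ _∨_ (Data.Bool.Properties.∧-comm ⌊ x ≟ v ⌋ ⌊ y ≟ u ⌋)
                 (Data.Bool.Properties.∧-comm ⌊ x ≟ u ⌋ ⌊ y ≟ v ⌋)))
    where
    import Data.Bool.Properties
    open import Relation.Binary.PropositionalEquality renaming (trans to trans₁)
  irrP : ∀ x → (adj H x x ∨ samePair u v x x) ≡ false
  irrP x rewrite Graph.irrefl H x with x ≟ u | x ≟ v
  ... | yes refl | yes refl = ⊥-elim (u≢v refl)
  ... | yes _ | no _ = refl
  ... | no _ | yes _ = refl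
  ... | no _ | no _ = refl

InBoundary : ∀ {k} → Graph k → ℕ → (u v : Fin k) → u ≢ v → Set
InBoundary H i u v u≢v = VC≡ H i × VC≡ (addEdge H u v u≢v) (suc i)

IsCore : ∀ {k} → Graph k → Subset k → Set
IsCore H S = ∀ C → IsMinVertexCover (induced H S) C → IsVertexCover H C

{-# OPTIONS --safe #-}
module Submission where

-- A core F = H[S] has the same vertex cover number as H: a minimum cover of F
-- covers H, and every cover of H covers F. Adding an edge e preserves this:
-- vc(F+e) ≤ vc(H+e) ≤ vc(H) + 1 = vc(F) + 1, and if vc(F+e) = vc(F), then a
-- minimum cover of F+e is a minimum cover of F, hence covers H and e, so
-- vc(H+e) = vc(F+e) in that case as well. With vc(F) = vc(H) and
-- vc(F+e) = vc(H+e), the two boundary conditions are literally the same.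

open import Defs hiding (sym)
open import Data.Bool using (true; false; T; _∧_; _∨_)
import Data.Bool.Properties as Bool
open import Data.Fin using (Fin; _≟_)
open import Data.Fin.Properties using (all?)
open import Data.Fin.Subset using (Subset; _∈_; ∣_∣; _∪_; ⁅_⁆; ⊤; inside; outside)
open import Data.Fin.Subset.Properties
  using (_∈?_; anySubset?; ∈⊤; x∈⁅x⁆; x∈p∪q⁺; ∣p∣≤∣x∷p∣; ∣⁅x⁆∣≡1)
open import Data.Nat using (ℕ; suc; _≤_; _<_; _+_; z≤n; s≤s; _<?_; _≤?_)
open import Data.Nat.Induction using (<-wellFounded)
open import Data.Nat.Properties
  using (module ≤-Reasoning; ≤-trans; ≤-antisym; ≮⇒≥; ≰⇒>; +-suc; +-comm; +-monoʳ-≤)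
open import Data.Product as Product using (Σ; _×_; _,_; proj₁; proj₂)
open import Data.Product.Function.NonDependent.Propositional using (_×-⇔_)
open import Data.Sum as Sum using (_⊎_; inj₁; inj₂)
open import Data.Vec using (_∷_; [])
open import Function.Bundles using (_⇔_; mk⇔; Equivalence)
open import Function.Construct.Identity using (⇔-id)
import Function.Properties.Equivalence as ⇔
open import Induction.WellFounded using (Acc; acc)
open import Relation.Binary.PropositionalEquality using (_≡_; _≢_; refl; sym; trans; cong)
open import Relation.Nullary using (Dec; yes; no; contradiction)
open import Relation.Nullary.Decidable using (⌊_⌋; toWitness; _→-dec_; _⊎-dec_; _×-dec_)

open Equivalence using (to; from)

private
  variable
    k i : ℕ
    C : Subset k
    x y : Fin k

∣p∪q∣≤∣p∣+∣q∣ : (p q : Subset k) → ∣ p ∪ q ∣ ≤ ∣ p ∣ + ∣ q ∣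
∣p∪q∣≤∣p∣+∣q∣ []            []            = z≤n
∣p∪q∣≤∣p∣+∣q∣ (inside  ∷ p) (b ∷ q)       =
  s≤s (≤-trans (∣p∪q∣≤∣p∣+∣q∣ p q) (+-monoʳ-≤ ∣ p ∣ (∣p∣≤∣x∷p∣ b q)))
∣p∪q∣≤∣p∣+∣q∣ (outside ∷ p) (inside  ∷ q) rewrite +-suc ∣ p ∣ ∣ q ∣ = s≤s (∣p∪q∣≤∣p∣+∣q∣ p q)
∣p∪q∣≤∣p∣+∣q∣ (outside ∷ p) (outside ∷ q) = ∣p∪q∣≤∣p∣+∣q∣ p q

isVertexCover? : (G : Graph k) (C : Subset k) → Dec (IsVertexCover G C)
isVertexCover? G C =
  all? λ u → all? λ v → (adj G u v Bool.≟ true) →-dec (u ∈? C ⊎-dec v ∈? C)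

⊤-isVertexCover : (G : Graph k) → IsVertexCover G ⊤
⊤-isVertexCover G _ _ _ = inj₁ ∈⊤

shrinkVertexCover : (G : Graph k) (C : Subset k) → IsVertexCover G C → Acc _<_ ∣ C ∣ →
                    Σ (Subset k) (IsMinVertexCover G)
shrinkVertexCover G C cov (acc smaller)
  with anySubset? (λ D → isVertexCover? G D ×-dec ∣ D ∣ <? ∣ C ∣)
... | yes (D , covD , D<C) = shrinkVertexCover G D covD (smaller D<C)
... | no ∄smaller = C , cov , λ D covD → ≮⇒≥ (λ D<C → ∄smaller (D , covD , D<C))

minVertexCover : (G : Graph k) → Σ (Subset k) (IsMinVertexCover G)
minVertexCover G = shrinkVertexCover G ⊤ (⊤-isVertexCover G) (<-wellFounded _)

vc : Graph k → ℕ
vc G = ∣ proj₁ (minVertexCover G) ∣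

module _ (G : Graph k) where

  private
    M = proj₁ (minVertexCover G)

  minVertexCover-isVertexCover : IsVertexCover G M
  minVertexCover-isVertexCover = proj₁ (proj₂ (minVertexCover G))

  vc≤∣C∣ : IsVertexCover G C → vc G ≤ ∣ C ∣
  vc≤∣C∣ = proj₂ (proj₂ (minVertexCover G)) _

  ∣C∣≤vc⇒isMinVertexCover : IsVertexCover G C → ∣ C ∣ ≤ vc G → IsMinVertexCover G C
  ∣C∣≤vc⇒isMinVertexCover cov C≤vc = cov , λ D covD → ≤-trans C≤vc (vc≤∣C∣ covD)

  isMinVertexCover⇒∣C∣≡vc : IsMinVertexCover G C → ∣ C ∣ ≡ vc G
  isMinVertexCover⇒∣C∣≡vc (cov , minimal) =
    ≤-antisym (minimal M minVertexCover-isVertexCover) (vc≤∣C∣ cov)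

  VC≡⇔vc≡ : VC≡ G i ⇔ vc G ≡ i
  VC≡⇔vc≡ = mk⇔ (λ (C , isMin , ∣C∣≡i) → trans (sym (isMinVertexCover⇒∣C∣≡vc isMin)) ∣C∣≡i)
                (λ { refl → M , proj₂ (minVertexCover G) , refl })

_⊆ᴳ_ : Graph k → Graph k → Set
G ⊆ᴳ G′ = ∀ x y → adj G x y ≡ true → adj G′ x y ≡ true

isVertexCover-antitone : (G G′ : Graph k) → G ⊆ᴳ G′ → IsVertexCover G′ C → IsVertexCover G C
isVertexCover-antitone G G′ G⊆G′ cov x y e = cov x y (G⊆G′ x y e)

vc-mono : (G G′ : Graph k) → G ⊆ᴳ G′ → vc G ≤ vc G′
vc-mono G G′ G⊆G′ =
  vc≤∣C∣ G (isVertexCover-antitone G G′ G⊆G′ (minVertexCover-isVertexCover G′))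

induced-⊆ᴳ : (H : Graph k) (S : Subset k) → induced H S ⊆ᴳ H
induced-⊆ᴳ H S x y e with adj H x y
... | true = refl

samePair-sound : (u v x y : Fin k) → samePair u v x y ≡ true → (x ≡ u × y ≡ v) ⊎ (x ≡ v × y ≡ u)
samePair-sound u v x y same =
  Sum.map (witnesses (x ≟ u) (y ≟ v)) (witnesses (x ≟ v) (y ≟ u)) (to Bool.T-∨ (from Bool.T-≡ same))
  where
  witnesses : ∀ {A B : Set} (a? : Dec A) (b? : Dec B) → T (⌊ a? ⌋ ∧ ⌊ b? ⌋) → A × B
  witnesses a? b? t = Product.map toWitness toWitness (to (Bool.T-∧ {⌊ a? ⌋}) t)

module _ (u v : Fin k) (u≢v : u ≢ v) where

  addEdge-⊇ᴳ : (G : Graph k) → G ⊆ᴳ addEdge G u v u≢v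
  addEdge-⊇ᴳ G x y e rewrite e = refl

  addEdge-mono : (G G′ : Graph k) → G ⊆ᴳ G′ → addEdge G u v u≢v ⊆ᴳ addEdge G′ u v u≢v
  addEdge-mono G G′ G⊆G′ x y e with adj G x y in exy
  ... | true  rewrite G⊆G′ x y exy = refl
  ... | false = trans (cong (adj G′ x y ∨_) e) (Bool.∨-zeroʳ (adj G′ x y))

  addEdge-adj-uv : (G : Graph k) → adj (addEdge G u v u≢v) u v ≡ true
  addEdge-adj-uv G with u ≟ u | v ≟ v
  ... | yes _   | yes _   = Bool.∨-zeroʳ (adj G u v)
  ... | no u≢u  | _       = contradiction refl u≢u
  ... | _       | no v≢v  = contradiction refl v≢v

  addEdge-adj⁻ : (G : Graph k) → adj (addEdge G u v u≢v) x y ≡ true →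
                 adj G x y ≡ true ⊎ (x ≡ u × y ≡ v) ⊎ (x ≡ v × y ≡ u)
  addEdge-adj⁻ {x} {y} G e with adj G x y
  ... | true  = inj₁ refl
  ... | false = inj₂ (samePair-sound u v x y e)

  isVertexCover-addEdge⁺ : (G : Graph k) → IsVertexCover G C → u ∈ C ⊎ v ∈ C →
                           IsVertexCover (addEdge G u v u≢v) C
  isVertexCover-addEdge⁺ G cov uv x y e with addEdge-adj⁻ G e
  ... | inj₁ exy                  = cov x y exy
  ... | inj₂ (inj₁ (refl , refl)) = uv
  ... | inj₂ (inj₂ (refl , refl)) = Sum.swap uv

  vc-addEdge≤ : (G : Graph k) → vc (addEdge G u v u≢v) ≤ suc (vc G)
  vc-addEdge≤ G = begin
    vc (addEdge G u v u≢v) ≤⟨ vc≤∣C∣ (addEdge G u v u≢v) (isVertexCover-addEdge⁺ G cov∪u u∈M∪u) ⟩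
    ∣ M ∪ ⁅ u ⁆ ∣          ≤⟨ ∣p∪q∣≤∣p∣+∣q∣ M ⁅ u ⁆ ⟩
    ∣ M ∣ + ∣ ⁅ u ⁆ ∣      ≡⟨ cong (∣ M ∣ +_) (∣⁅x⁆∣≡1 u) ⟩
    ∣ M ∣ + 1              ≡⟨ +-comm ∣ M ∣ 1 ⟩
    suc (vc G)             ∎
    where
    open ≤-Reasoning
    M = proj₁ (minVertexCover G)
    cov∪u : IsVertexCover G (M ∪ ⁅ u ⁆)
    cov∪u x y e = Sum.map (λ x∈M → x∈p∪q⁺ (inj₁ x∈M)) (λ y∈M → x∈p∪q⁺ (inj₁ y∈M))
                          (minVertexCover-isVertexCover G x y e)
    u∈M∪u : u ∈ M ∪ ⁅ u ⁆ ⊎ v ∈ M ∪ ⁅ u ⁆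
    u∈M∪u = inj₁ (x∈p∪q⁺ {p = M} (inj₂ (x∈⁅x⁆ u)))

module _ (H : Graph k) (S : Subset k) (core : IsCore H S) where

  private
    F = induced H S

  core-vc≡ : vc (induced H S) ≡ vc H
  core-vc≡ = ≤-antisym (vc-mono F H (induced-⊆ᴳ H S))
                       (vc≤∣C∣ H (core _ (proj₂ (minVertexCover F))))

  core-vc-addEdge≡ : (u v : Fin k) (u≢v : u ≢ v) →
                     vc (addEdge (induced H S) u v u≢v) ≡ vc (addEdge H u v u≢v)
  core-vc-addEdge≡ u v u≢v =
    ≤-antisym (vc-mono Fe He (addEdge-mono u v u≢v F H (induced-⊆ᴳ H S))) He≤Fe
    where
    Fe = addEdge F u v u≢v
    He = addEdge H u v u≢v
    E = proj₁ (minVertexCover Fe)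
    covE : IsVertexCover Fe E
    covE = minVertexCover-isVertexCover Fe
    He≤Fe : vc He ≤ vc Fe
    He≤Fe with vc Fe ≤? vc F
    ... | yes small =
      vc≤∣C∣ He (isVertexCover-addEdge⁺ u v u≢v H (core E minE) (covE u v (addEdge-adj-uv u v u≢v F)))
      where
      minE : IsMinVertexCover F E
      minE = ∣C∣≤vc⇒isMinVertexCover F (isVertexCover-antitone F Fe (addEdge-⊇ᴳ u v u≢v F) covE) small
    ... | no large = begin
      vc He      ≤⟨ vc-addEdge≤ u v u≢v H ⟩
      suc (vc H) ≡⟨ cong suc (sym core-vc≡) ⟩
      suc (vc F) ≤⟨ ≰⇒> large ⟩
      vc Fe      ∎
      where open ≤-Reasoning

InBoundary⇔vc≡ : (G : Graph k) (i : ℕ) (u v : Fin k) (u≢v : u ≢ v) →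
                 InBoundary G i u v u≢v ⇔ (vc G ≡ i × vc (addEdge G u v u≢v) ≡ suc i)
InBoundary⇔vc≡ G i u v u≢v = VC≡⇔vc≡ G ×-⇔ VC≡⇔vc≡ (addEdge G u v u≢v)

proposition4p3 : ∀ (k : ℕ) (H : Graph k) (S : Subset k) → IsCore H S →
    ∀ (i : ℕ) (u v : Fin k) (u≢v : u ≢ v) →
    InBoundary (induced H S) i u v u≢v ⇔ InBoundary H i u v u≢v
proposition4p3 k H S core i u v u≢v =
  ⇔.trans (InBoundary⇔vc≡ (induced H S) i u v u≢v)
          (⇔.trans sameNumbers (⇔.sym (InBoundary⇔vc≡ H i u v u≢v)))
  where
  sameNumbers : (vc (induced H S) ≡ i × vc (addEdge (induced H S) u v u≢v) ≡ suc i) ⇔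
                (vc H ≡ i × vc (addEdge H u v u≢v) ≡ suc i)
  sameNumbers rewrite core-vc≡ H S core | core-vc-addEdge≡ H S core u v u≢v = ⇔-id _
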